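{- Let $f:\mathbb{R}_D\to\mathbb{R}_D$ be pointwise continuous, locally nonconstant, and equipped with a structure of lifting locators. Let $x,y,t:\mathbb{R}_D$ be equipped with locators, with $x<y$. Then one can construct $r:\mathbb{Q}$ with $x<r<y$ and $f(r)\mathrel{\#}t$.
   Context: Work in Martin-Löf type theory with propositional truncation, function extensionality and propositional extensionality. A Dedekind real is a pair $x=(L,U)$ of proposition-valued predicates on $\mathbb{Q}$, writing $q<x$ for $q\in L$ and $x<r$ for $r\in U$, which is bounded, rounded, transitive and located ($q<r\Rightarrow\|(q<x)+(x<r)\|$). $\mathbb{R}_D$ is the type of Dedekind reals, with $x<y:=\exists_{q:\mathbb{Q}}x<q<y$ and apartness $x\mathrel{\#}y:=(x<y)\lor(y<x)$. $f$ is pointwise continuous if for all $x$: $\forall\varepsilon:\mathbb{Q}_+\exists\delta:\mathbb{Q}_+\forall y.\,|x-y|<\delta\Rightarrow|f(x)-f(y)|<\varepsilon$. $f$ is locally nonconstant if for all $x<y$ and $t:\mathbb{R}_D$ there exists $z$ with $x<z<y$ and $f(z)\mathrel{\#}t$. A locator for $x$ is a function $\prod_{q,r:\mathbb{Q}}(q<r)\to(q<x)+(x<r)$ into the untruncated disjoint sum; $f$ lifts locators if it is equipped with an element of $\prod_{x:\mathbb{R}_D}\operatorname{locator}(x)\to\operatorname{locator}(f(x))$. -}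

module Defs where

open import Level using (Level; _⊔_) renaming (suc to lsuc; zero to lzero)
open import Data.Product using (Σ; _×_; _,_; proj₁; proj₂)
open import Data.Sum using (_⊎_; inj₁; inj₂)
open import Data.Rational using (ℚ; _<_; _-_; _+_; 0ℚ; 1ℚ; -_)
open import Data.Rational.Properties as ℚP using ()
open import Relation.Binary.PropositionalEquality using (_≡_; refl; subst; sym)
open import Relation.Binary.Definitions using (tri<; tri≈; tri>)

isProp : ∀ {a} → Set a → Set a
isProp P = (p q : P) → p ≡ q

∥_∥ : ∀ {a} → Set a → Set (lsuc a)
∥_∥ {a} A = (P : Set a) → isProp P → (A → P) → P

∣_∣ : ∀ {a} {A : Set a} → A → ∥ A ∥
∣ x ∣ P _ f = f x

_⇔_ : ∀ {a b} → Set a → Set b → Set (a ⊔ b)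
A ⇔ B = (A → B) × (B → A)

ℚ₊ : Set
ℚ₊ = Σ ℚ (λ ε → 0ℚ < ε)

-- Dedekind reals: L q means q < x, U r means x < r.

record ℝD : Set₁ where
  field
    L U         : ℚ → Set
    L-prop      : ∀ q → isProp (L q)
    U-prop      : ∀ r → isProp (U r)
    bounded-L   : ∥ Σ ℚ L ∥
    bounded-U   : ∥ Σ ℚ U ∥
    rounded-L   : ∀ q → L q ⇔ ∥ Σ ℚ (λ q' → (q < q') × L q') ∥
    rounded-U   : ∀ r → U r ⇔ ∥ Σ ℚ (λ r' → (r' < r) × U r') ∥
    transitive  : ∀ q r → L q → U r → q < r
    located     : ∀ q r → q < r → ∥ L q ⊎ U r ∥

open ℝD public

_<ℚℝ_ : ℚ → ℝD → Set
q <ℚℝ x = L x q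

_<ℝℚ_ : ℝD → ℚ → Set
x <ℝℚ r = U x r

_<ℝ_ : ℝD → ℝD → Set₁
x <ℝ y = ∥ Σ ℚ (λ q → (x <ℝℚ q) × (q <ℚℝ y)) ∥

_#_ : ℝD → ℝD → Set₂
x # y = ∥ (x <ℝ y) ⊎ (y <ℝ x) ∥

Locator : ℝD → Set
Locator x = (q r : ℚ) → q < r → (q <ℚℝ x) ⊎ (x <ℝℚ r)

private
  below : ∀ r → (r - 1ℚ) < r
  below r = subst (λ z → (r - 1ℚ) < z) (ℚP.+-identityʳ r)
              (ℚP.+-monoʳ-< r (ℚP.negative⁻¹ (- 1ℚ)))

  above : ∀ r → r < (r + 1ℚ)
  above r = subst (λ z → z < (r + 1ℚ)) (ℚP.+-identityʳ r)
              (ℚP.+-monoʳ-< r (ℚP.positive⁻¹ 1ℚ))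

ι : ℚ → ℝD
ι r = record
  { L = λ q → q < r
  ; U = λ s → r < s
  ; L-prop = λ q → ℚP.<-irrelevant
  ; U-prop = λ s → ℚP.<-irrelevant
  ; bounded-L = ∣ (r - 1ℚ) , below r ∣
  ; bounded-U = ∣ (r + 1ℚ) , above r ∣
  ; rounded-L = λ q →
      (λ q<r → let (m , q<m , m<r) = ℚP.<-dense q<r in ∣ m , q<m , m<r ∣)
    , (λ h → h (q < r) ℚP.<-irrelevant (λ where (q' , q<q' , q'<r) → ℚP.<-trans q<q' q'<r))
  ; rounded-U = λ s →
      (λ r<s → let (m , r<m , m<s) = ℚP.<-dense r<s in ∣ m , m<s , r<m ∣)
    , (λ h → h (r < s) ℚP.<-irrelevant (λ where (s' , s'<s , r<s') → ℚP.<-trans r<s' s'<s))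
  ; transitive = λ q s q<r r<s → ℚP.<-trans q<r r<s
  ; located = λ q s q<s → ∣ loc q s q<s ∣
  }
  where
  loc : ∀ q s → q < s → (q < r) ⊎ (r < s)
  loc q s q<s with ℚP.<-cmp q r
  ... | tri< q<r _ _ = inj₁ q<r
  ... | tri≈ _ refl _ = inj₂ q<s
  ... | tri> _ _ r<q = inj₂ (ℚP.<-trans r<q q<s)

-- |x - y| < δ  (δ rational), with the upper cut of |x - y| written out:
--   U(x - y) = { b - c | x < b, c < y },   U(-(x - y)) = U(y - x),
--   U |z| = U(max(z, -z)) = U z ∩ U(-z),
-- and  |x - y| < δ  :=  ∃ q. |x - y| < q < δ  (real order against ι δ).

U-absdiff : ℝD → ℝD → ℚ → Set₁
U-absdiff x y q =
    ∥ Σ ℚ (λ b → Σ ℚ (λ c → (x <ℝℚ b) × (c <ℚℝ y) × (q ≡ b - c))) ∥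
  × ∥ Σ ℚ (λ d → Σ ℚ (λ a → (y <ℝℚ d) × (a <ℚℝ x) × (q ≡ d - a))) ∥

absdiff<_ : ℝD → ℝD → ℚ → Set₂
absdiff<_ x y δ = ∥ Σ ℚ (λ q → U-absdiff x y q × (q < δ)) ∥

PointwiseContinuous : (ℝD → ℝD) → Set₃
PointwiseContinuous f =
  (x : ℝD) → (ε : ℚ₊) →
    ∥ Σ ℚ₊ (λ δ → (y : ℝD) → absdiff<_ x y (proj₁ δ) →
                    absdiff<_ (f x) (f y) (proj₁ ε)) ∥

LocallyNonconstant : (ℝD → ℝD) → Set₃
LocallyNonconstant f =
  (x y : ℝD) → x <ℝ y → (t : ℝD) →
    ∥ Σ ℝD (λ z → (x <ℝ z) × (z <ℝ y) × (f z # t)) ∥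

LiftsLocators : (ℝD → ℝD) → Set₁
LiftsLocators f = (x : ℝD) → Locator x → Locator (f x)

module Submission where

-- Local nonconstancy gives a real z with x < z < y and f z # t; continuity
-- keeps f w # t for all w near z; locatedness of z gives a rational r that
-- near, with x < r < y.  This shows only that a suitable r MERELY exists.
-- To construct one, note that with the locators of x, y, t and (lifted) of
-- f (ι r) the property "r works" has finite rational certificates that can
-- be checked by a Maybe-valued procedure.  Certificates are enumerated by
-- ℕ, and a decidable predicate on ℕ that merely holds has a unique least
-- witness, which can therefore be extracted from the truncation.

open import Defs
open import Data.Rational using (ℚ)
open import Data.Product using (Σ; _×_)

open import Level using (Level; Lift; lift; lower; _⊔_) renaming (zero to lzero; suc to lsuc)
open import Function using (_∘_; _↠_)
open import Function.Bundles using (mk↠ₛ; module Surjection; module Equivalence)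
open import Function.Construct.Identity using (↠-id)
open import Function.Construct.Composition using (_↠-∘_)
open import Data.Product using (_,_; proj₁; proj₂)
open import Data.Product.Function.NonDependent.Propositional using (_×-↠_)
open import Data.Sum using (inj₁; inj₂)
open import Data.Empty using (⊥; ⊥-elim)
open import Data.Unit using (tt)
open import Data.Bool using (Bool; true; false; not; _∧_; T)
open import Data.Bool.Properties using (T-irrelevant; T-∧; T-not-≡)
open import Data.Maybe using (Maybe; just; nothing; is-just; map; zip; _<∣>_; to-witness-T)
open import Data.Nat as ℕ using (ℕ; zero; suc; s≤s)
import Data.Nat.Properties as ℕP
import Data.Nat.Coprimality as Coprimality
open import Data.Integer as ℤ using (ℤ; +_; -[1+_])
import Data.Integer.Properties as ℤP
open import Data.Integer.Tactic.RingSolver using (solve-∀)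
open import Data.Rational
  using (mkℚ; _/_; _<_; _≤_; _+_; _*_; _-_; -_; 0ℚ; 1ℚ; 1/_; *≤*; _<?_;
         NonZero; NonNegative; >-nonZero; positive)
import Data.Rational.Properties as ℚP
open import Data.Rational.Unnormalised using () renaming (*≡* to *≡*ᵘ)
import Data.Rational.Unnormalised.Properties as ℚᵘP
open import Data.Rational.Solver using (module +-*-Solver)
open import Algebra.Bundles using (Ring)
open import Algebra.Properties.Semiring.Mult (Ring.semiring ℚP.+-*-ring)
  using (×-assoc-*) renaming (_×_ to _·_)
open import Relation.Nullary using (yes; no)
open import Relation.Binary.PropositionalEquality
  using (_≡_; refl; sym; trans; cong; cong₂; subst; subst₂)
open import Relation.Binary.Definitions using (tri<; tri≈; tri>)

private
  variable
    a b : Level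
    A : Set a
    B : Set b

-- The truncations of Defs eliminate into propositions of their own
-- universe; all we ever eliminate into are propositions in Set.  Restricted
-- to those, mere existence is a monad, so existential hypotheses can be
-- chained in do-notation.
Merely : Set a → Set (lsuc lzero ⊔ a)
Merely A = (P : Set) → isProp P → (A → P) → P

merely : ∥ A ∥ → Merely A
merely h P P-prop k =
  lower (h (Lift _ P) (λ p q → cong lift (P-prop (lower p) (lower q))) (lift ∘ k))

return : A → Merely A
return x P _ k = k x

_>>=_ : Merely A → (A → Merely B) → Merely B
(m >>= g) P P-prop k = m P P-prop (λ x → g x P P-prop k)

escape : {P : Set} → isProp P → Merely P → P
escape P-prop m = m _ P-prop (λ p → p)

module _ where
  open +-*-Solver

  window-width : ∀ c k → (c + k) - c ≡ k
  window-width = solve 2 (λ c k → (c :+ k) :- c := k) refl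

  difference-bounds-above : ∀ {d a q s} → d - a < q - s → a < s → d < q
  difference-bounds-above {d} {a} {q} {s} lt a<s =
    subst₂ _<_ (shift d a) (shift q s) (ℚP.+-mono-< lt a<s)
    where
    shift : ∀ u v → (u - v) + v ≡ u
    shift = solve 2 (λ u v → (u :- v) :+ v := u) refl

  difference-bounds-below : ∀ {b c s q} → b - c < s - q → s < b → q < c
  difference-bounds-below {b} {c} {s} {q} lt s<b =
    subst₂ _<_ (cancel s q) (cancel b c) (ℚP.+-mono-< s<b (ℚP.neg-antimono-< lt))
    where
    cancel : ∀ u v → u - (u - v) ≡ v
    cancel = solve 2 (λ u v → u :- (u :- v) := v) refl

  difference-bound : ∀ {a b e} → b - a ≤ e → b ≤ a + e
  difference-bound {a} {b} b-a≤e =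
    subst (_≤ a + _) (restore a b) (ℚP.+-monoʳ-≤ a b-a≤e)
    where
    restore : ∀ u v → u + (v - u) ≡ v
    restore = solve 2 (λ u v → u :+ (v :- u) := v) refl

0<difference : ∀ {s q} → s < q → 0ℚ < q - s
0<difference {s} {q} s<q = subst (_< q - s) (ℚP.+-inverseʳ s) (ℚP.+-monoˡ-< (- s) s<q)

<-+positive : ∀ c {h} → 0ℚ < h → c < c + h
<-+positive c 0<h = subst (_< c + _) (ℚP.+-identityʳ c) (ℚP.+-monoʳ-< c 0<h)

between-below-both : ∀ {c m m′} → c < m → c < m′ → Σ ℚ λ r → c < r × r < m × r < m′
between-below-both {c} {m} {m′} c<m c<m′ with ℚP.≤-total m m′
... | inj₁ m≤m′ = let (r , c<r , r<m) = ℚP.<-dense c<m in r , c<r , r<m , ℚP.<-≤-trans r<m m≤m′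
... | inj₂ m′≤m = let (r , c<r , r<m′) = ℚP.<-dense c<m′ in r , c<r , ℚP.<-≤-trans r<m′ m′≤m , r<m′

ℕ→ℚ : ℕ → ℚ
ℕ→ℚ n = mkℚ (+ n) 0 (Coprimality.sym (Coprimality.1-coprimeTo n))

ℕ→ℚ-suc : ∀ n → 1ℚ + ℕ→ℚ n ≡ ℕ→ℚ (suc n)
ℕ→ℚ-suc n = ℚP.toℚᵘ-injective (ℚᵘP.≃-trans (ℚP.toℚᵘ-homo-+ 1ℚ (ℕ→ℚ n)) (*≡*ᵘ (cross (+ n))))
  where
  cross : ∀ (m : ℤ) → (+ 1 ℤ.* + 1 ℤ.+ m ℤ.* + 1) ℤ.* + 1 ≡ (+ 1 ℤ.+ m) ℤ.* (+ 1 ℤ.* + 1)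
  cross = solve-∀

ℕ→ℚ-sum : ∀ n → ℕ→ℚ n ≡ n · 1ℚ
ℕ→ℚ-sum zero = refl
ℕ→ℚ-sum (suc n) = trans (sym (ℕ→ℚ-suc n)) (cong (λ q → 1ℚ + q) (ℕ→ℚ-sum n))

-- Every rational is bounded by a natural number: p / q ≤ p for p ≥ 0.
natural-bound : ∀ w → Σ ℕ λ n → w ≤ ℕ→ℚ n
natural-bound (mkℚ (+ n) _ _) = n , *≤* (ℤP.*-monoˡ-≤-nonNeg (+ n) (ℤ.+≤+ (s≤s ℕ.z≤n)))
natural-bound (mkℚ -[1+ _ ] _ _) = 0 , *≤* ℤ.-≤+

archimedean : ∀ C h → 0ℚ < h → Σ ℕ λ n → C ≤ n · h
archimedean C h 0<h =
  let (n , quotient≤n) = natural-bound (C * 1/ h) in n , (begin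
    C                     ≡⟨ quotient-times-h ⟨
    (C * 1/ h) * h        ≤⟨ ℚP.*-monoʳ-≤-nonNeg h {{h-nonNegative}} quotient≤n ⟩
    ℕ→ℚ n * h             ≡⟨ cong (_* h) (ℕ→ℚ-sum n) ⟩
    (n · 1ℚ) * h          ≡⟨ ×-assoc-* n 1ℚ h ⟩
    n · (1ℚ * h)          ≡⟨ cong (n ·_) (ℚP.*-identityˡ h) ⟩
    n · h                 ∎)
  where
  open ℚP.≤-Reasoning
  instance
    h-nonZero : NonZero h
    h-nonZero = >-nonZero 0<h
  h-nonNegative : NonNegative h
  h-nonNegative = ℚP.pos⇒nonNeg h {{positive 0<h}}
  quotient-times-h : (C * 1/ h) * h ≡ C
  quotient-times-h = trans (ℚP.*-assoc C (1/ h) h)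
                       (trans (cong (C *_) (ℚP.*-inverseˡ h)) (ℚP.*-identityʳ C))

window-close : (u v : ℝD) {c k δ : ℚ} → c <ℚℝ u → u <ℝℚ (c + k) →
               c <ℚℝ v → v <ℝℚ (c + k) → k < δ → absdiff<_ u v δ
window-close u v {c} {k} c<u u<c+k c<v v<c+k k<δ =
  ∣ k , (∣ c + k , c , u<c+k , c<v , width ∣ , ∣ c + k , c , v<c+k , c<u , width ∣) , k<δ ∣
  where
  width : k ≡ (c + k) - c
  width = sym (window-width c k)

close-upper : (u v : ℝD) {s q : ℚ} → absdiff<_ u v (q - s) → u <ℝℚ s → v <ℝℚ q
close-upper u v {s} {q} u≈v u<s = escape (U-prop v q) (do
  (e , (_ , v-u<e) , e<q-s) ← merely u≈v
  (d , a , v<d , a<u , e≡d-a) ← merely v-u<e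
  let d<q = difference-bounds-above (subst (_< q - s) e≡d-a e<q-s) (transitive u a s a<u u<s)
  return (proj₂ (rounded-U v q) ∣ d , d<q , v<d ∣))

close-lower : (u v : ℝD) {s q : ℚ} → absdiff<_ u v (s - q) → s <ℚℝ u → q <ℚℝ v
close-lower u v {s} {q} u≈v s<u = escape (L-prop v q) (do
  (e , (u-v<e , _) , e<s-q) ← merely u≈v
  (b , c , u<b , c<v , e≡b-c) ← merely u-v<e
  let q<c = difference-bounds-below (subst (_< s - q) e≡b-c e<s-q) (transitive u s b s<u u<b)
  return (proj₂ (rounded-L v q) ∣ c , q<c , c<v ∣))

-- Locatedness, iterated: for 0 < h < k and a < z < b, stepping c upward
-- from a in steps of h until "z < c + k" is reported finds a window
-- (c , c + k) around z; the Archimedean property bounds the steps.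
locate : (z : ℝD) {a b h k : ℚ} → a <ℚℝ z → z <ℝℚ b → 0ℚ < h → h < k →
         Merely (Σ ℚ λ c → a ≤ c × c <ℚℝ z × z <ℝℚ (c + k))
locate z {a} {b} {h} {k} a<z z<b 0<h h<k =
  let (n , b-a≤nh) = archimedean (b - a) h 0<h
  in scan n a ℚP.≤-refl a<z (difference-bound b-a≤nh)
  where
  scan : (m : ℕ) (c : ℚ) → a ≤ c → c <ℚℝ z → b ≤ c + m · h →
         Merely (Σ ℚ λ c → a ≤ c × c <ℚℝ z × z <ℝℚ (c + k))
  scan zero c _ c<z b≤c+0 =
    ⊥-elim (ℚP.<-irrefl refl (ℚP.<-≤-trans (transitive z c b c<z z<b)
                                             (subst (b ≤_) (ℚP.+-identityʳ c) b≤c+0)))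
  scan (suc m) c a≤c c<z b≤c+h+mh = do
    inj₁ c+h<z ← merely (located z (c + h) (c + k) (ℚP.+-monoʳ-< c h<k))
      where inj₂ z<c+k → return (c , a≤c , c<z , z<c+k)
    scan m (c + h) (ℚP.≤-trans a≤c (ℚP.<⇒≤ (<-+positive c 0<h))) c+h<z
         (subst (b ≤_) (sym (ℚP.+-assoc c h (m · h))) b≤c+h+mh)

rational-near : (z : ℝD) {a b : ℚ} → a <ℚℝ z → z <ℝℚ b → (δ : ℚ) → 0ℚ < δ →
                Merely (Σ ℚ λ r → a < r × r < b × absdiff<_ z (ι r) δ)
rational-near z {a} {b} a<z z<b δ 0<δ = do
  let (k , 0<k , k<δ) = ℚP.<-dense 0<δ
      (h , 0<h , h<k) = ℚP.<-dense 0<k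
  (c , a≤c , c<z , z<c+k) ← locate z a<z z<b 0<h h<k
  let (r , c<r , r<c+k , r<b) = between-below-both (<-+positive c 0<k) (transitive z c b c<z z<b)
  return (r , ℚP.≤-<-trans a≤c c<r , r<b , window-close z (ι r) c<z z<c+k c<r r<c+k k<δ)

below-persists : (f : ℝD → ℝD) → PointwiseContinuous f → (z t : ℝD) → f z <ℝ t →
                 Merely (Σ ℚ₊ λ δ → (w : ℝD) → absdiff<_ z w (proj₁ δ) → f w <ℝ t)
below-persists f continuous z t fz<t = do
  (q , fz<q , q<t) ← merely fz<t
  (s , s<q , fz<s) ← merely (proj₁ (rounded-U (f z) q) fz<q)
  (δ , f-close) ← merely (continuous z (q - s , 0<difference s<q))
  return (δ , λ w z≈w → ∣ q , close-upper (f z) (f w) (f-close w z≈w) fz<s , q<t ∣)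

above-persists : (f : ℝD → ℝD) → PointwiseContinuous f → (z t : ℝD) → t <ℝ f z →
                 Merely (Σ ℚ₊ λ δ → (w : ℝD) → absdiff<_ z w (proj₁ δ) → t <ℝ f w)
above-persists f continuous z t t<fz = do
  (q , t<q , q<fz) ← merely t<fz
  (s , q<s , s<fz) ← merely (proj₁ (rounded-L (f z) q) q<fz)
  (δ , f-close) ← merely (continuous z (s - q , 0<difference q<s))
  return (δ , λ w z≈w → ∣ q , t<q , close-lower (f z) (f w) (f-close w z≈w) s<fz ∣)

apart-persists : (f : ℝD → ℝD) → PointwiseContinuous f → (z t : ℝD) → f z # t →
                 Merely (Σ ℚ₊ λ δ → (w : ℝD) → absdiff<_ z w (proj₁ δ) → f w # t)
apart-persists f continuous z t fz#t = merely fz#t >>= λ where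
  (inj₁ fz<t) → do
    (δ , near) ← below-persists f continuous z t fz<t
    return (δ , λ w z≈w → ∣ inj₁ (near w z≈w) ∣)
  (inj₂ t<fz) → do
    (δ , near) ← above-persists f continuous z t t<fz
    return (δ , λ w z≈w → ∣ inj₂ (near w z≈w) ∣)

is-just-map : (g : A → B) (m : Maybe A) → T (is-just m) → T (is-just (map g m))
is-just-map g (just _) _ = tt

is-just-zip : (m : Maybe A) (n : Maybe B) → T (is-just m) → T (is-just n) → T (is-just (zip m n))
is-just-zip (just _) (just _) _ _ = tt

is-just-<∣>ˡ : (m n : Maybe A) → T (is-just m) → T (is-just (m <∣> n))
is-just-<∣>ˡ (just _) n _ = tt

is-just-<∣>ʳ : (m n : Maybe A) → T (is-just n) → T (is-just (m <∣> n))
is-just-<∣>ʳ (just _) n _ = tt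
is-just-<∣>ʳ nothing n ok = ok

-- With a locator, a < w is confirmed by asking the locator about some
-- u < w; the answer "a < w" is certain to come when a < u.
upper? : (α : ℝD) → Locator α → (u w : ℚ) → Maybe (α <ℝℚ w)
upper? α locα u w with u <? w
... | no _ = nothing
... | yes u<w with locα u w u<w
...   | inj₁ _ = nothing
...   | inj₂ α<w = just α<w

upper?-complete : (α : ℝD) (locα : Locator α) {u w : ℚ} → α <ℝℚ u → u < w →
                  T (is-just (upper? α locα u w))
upper?-complete α locα {u} {w} α<u u<w with u <? w
... | no u≮w = ⊥-elim (u≮w u<w)
... | yes u<w′ with locα u w u<w′
...   | inj₁ u<α = ⊥-elim (ℚP.<-irrefl refl (transitive α u u u<α α<u))
...   | inj₂ _ = tt

-- Dually, w < a is confirmed by asking about w < v, and certain when v < a.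
lower? : (α : ℝD) → Locator α → (w v : ℚ) → Maybe (w <ℚℝ α)
lower? α locα w v with w <? v
... | no _ = nothing
... | yes w<v with locα w v w<v
...   | inj₁ w<α = just w<α
...   | inj₂ _ = nothing

lower?-complete : (α : ℝD) (locα : Locator α) {w v : ℚ} → v <ℚℝ α → w < v →
                  T (is-just (lower? α locα w v))
lower?-complete α locα {w} {v} v<α w<v with w <? v
... | no w≮v = ⊥-elim (w≮v w<v)
... | yes w<v′ with locα w v w<v′
...   | inj₁ _ = tt
...   | inj₂ α<v = ⊥-elim (ℚP.<-irrefl refl (transitive α v v v<α α<v))

ι-locator : (r : ℚ) → Locator (ι r)
ι-locator r q s q<s with q <? r
... | yes q<r = inj₁ q<r
... | no q≮r = inj₂ (ℚP.≤-<-trans (ℚP.≮⇒≥ q≮r) q<s)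

-- A certificate for α < β is a triple u < w < v with α < u and v < β.
Triple : Set
Triple = ℚ × ℚ × ℚ

less? : (α : ℝD) → Locator α → (β : ℝD) → Locator β → Triple → Maybe (α <ℝ β)
less? α locα β locβ (u , w , v) =
  map (λ (α<w , w<β) → ∣ w , α<w , w<β ∣) (zip (upper? α locα u w) (lower? β locβ w v))

less?-complete : (α : ℝD) (locα : Locator α) (β : ℝD) (locβ : Locator β) → α <ℝ β →
                 Merely (Σ Triple λ c → T (is-just (less? α locα β locβ c)))
less?-complete α locα β locβ α<β = do
  (w , α<w , w<β) ← merely α<β
  (u , u<w , α<u) ← merely (proj₁ (rounded-U α w) α<w)
  (v , w<v , v<β) ← merely (proj₁ (rounded-L β w) w<β)
  return ((u , w , v) , is-just-map _ _ (is-just-zip _ _ (upper?-complete α locα α<u u<w)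
                                                          (lower?-complete β locβ v<β w<v)))

apart? : (α : ℝD) → Locator α → (β : ℝD) → Locator β → Triple → Maybe (α # β)
apart? α locα β locβ c =
  map (λ α<β → ∣ inj₁ α<β ∣) (less? α locα β locβ c) <∣> map (λ β<α → ∣ inj₂ β<α ∣) (less? β locβ α locα c)

apart?-complete : (α : ℝD) (locα : Locator α) (β : ℝD) (locβ : Locator β) → α # β →
                  Merely (Σ Triple λ c → T (is-just (apart? α locα β locβ c)))
apart?-complete α locα β locβ α#β = merely α#β >>= λ where
  (inj₁ α<β) → do
    (c , ok) ← less?-complete α locα β locβ α<β
    return (c , is-just-<∣>ˡ _ _ (is-just-map _ _ ok))
  (inj₂ β<α) → do
    (c , ok) ← less?-complete β locβ α locα β<α
    return (c , is-just-<∣>ʳ _ _ (is-just-map _ _ ok))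

-- The least witness is unique, hence a proposition, so it can be extracted
-- from the truncation; it is found by scanning upward from 0.
module LeastWitness (d : ℕ → Bool) where

  none-below : ℕ → Bool
  none-below zero = true
  none-below (suc n) = not (d n) ∧ none-below n

  Least : Set
  Least = Σ ℕ λ n → T (d n) × T (none-below n)

  none-below-sound : ∀ {m n} → T (none-below n) → m ℕ.< n → T (d m) → ⊥
  none-below-sound {m} {suc n} nb (s≤s m≤n) dm
    with Equivalence.to T-∧ nb | ℕP.m≤n⇒m<n∨m≡n m≤n
  ... | _ , nb′ | inj₁ m<n = none-below-sound nb′ m<n dm
  ... | ¬dm , _ | inj₂ refl = subst T (Equivalence.to T-not-≡ ¬dm) dm

  Least-isProp : isProp Least
  Least-isProp (n , dn , nbn) (m , dm , nbm) with ℕP.<-cmp n m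
  ... | tri< n<m _ _ = ⊥-elim (none-below-sound nbm n<m dn)
  ... | tri≈ _ refl _ = cong₂ (λ p q → n , p , q) (T-irrelevant dn dm) (T-irrelevant nbn nbm)
  ... | tri> _ _ m<n = ⊥-elim (none-below-sound nbn m<n dm)

  scan : (j k : ℕ) → T (none-below k) → T (d (j ℕ.+ k)) → Least
  scan zero k nb dk = k , dk , nb
  scan (suc j) k nb dj+k with d k in dk
  ... | true = k , subst T (sym dk) tt , nb
  ... | false = scan j (suc k) (subst (λ b → T (not b ∧ none-below k)) (sym dk) nb)
                     (subst (T ∘ d) (sym (ℕP.+-suc j k)) dj+k)

  least : Σ ℕ (T ∘ d) → Least
  least (n , dn) = scan n 0 tt (subst (T ∘ d) (sym (ℕP.+-identityʳ n)) dn)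

ℕ-search : (d : ℕ → Bool) → Merely (Σ ℕ (T ∘ d)) → Σ ℕ (T ∘ d)
ℕ-search d exists = let (n , dn , _) = exists Least Least-isProp least in n , dn
  where open LeastWitness d

-- Cantor's enumeration of ℕ × ℕ walks each anti-diagonal a + b = s from
-- (0 , s) to (s , 0), then starts the next one at (0 , s + 1).
next : ℕ × ℕ → ℕ × ℕ
next (a , zero) = zero , suc a
next (a , suc b) = suc a , b

cantor : ℕ → ℕ × ℕ
cantor zero = 0 , 0
cantor (suc n) = next (cantor n)

diagonal-start : ℕ → ℕ
diagonal-start zero = zero
diagonal-start (suc s) = suc (s ℕ.+ diagonal-start s)

along-diagonal : ∀ {s} → cantor (diagonal-start s) ≡ (0 , s) →
                 ∀ a b → a ℕ.+ b ≡ s → cantor (a ℕ.+ diagonal-start s) ≡ (a , b)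
along-diagonal start zero b refl = start
along-diagonal start (suc a) b a+1+b≡s =
  cong next (along-diagonal start a (suc b) (trans (ℕP.+-suc a b) a+1+b≡s))

cantor-diagonal : ∀ s → cantor (diagonal-start s) ≡ (0 , s)
cantor-diagonal zero = refl
cantor-diagonal (suc s) = cong next (along-diagonal (cantor-diagonal s) s 0 (ℕP.+-identityʳ s))

ℕ↠ℕ×ℕ : ℕ ↠ (ℕ × ℕ)
ℕ↠ℕ×ℕ = mk↠ₛ {to = cantor} λ (a , b) →
  a ℕ.+ diagonal-start (a ℕ.+ b) , along-diagonal (cantor-diagonal (a ℕ.+ b)) a b refl

_⊗_ : ℕ ↠ A → ℕ ↠ B → ℕ ↠ (A × B)
enumA ⊗ enumB = (enumA ×-↠ enumB) ↠-∘ ℕ↠ℕ×ℕ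

ℕ↠ℤ : ℕ ↠ ℤ
ℕ↠ℤ = mk↠ₛ {to = signed} (λ where
        (+ a) → (a , 0) , refl
        -[1+ a ] → (a , 1) , refl) ↠-∘ ℕ↠ℕ×ℕ
  where
  signed : ℕ × ℕ → ℤ
  signed (a , zero) = + a
  signed (a , suc _) = -[1+ a ]

ℕ↠ℚ : ℕ ↠ ℚ
ℕ↠ℚ = mk↠ₛ {to = fraction} (λ p@(mkℚ i d _) → (i , d) , ℚP.↥p/↧p≡p p)
        ↠-∘ (ℕ↠ℤ ⊗ ↠-id ℕ)
  where
  fraction : ℤ × ℕ → ℚ
  fraction (i , d) = i / suc d

search : {Output : A → Set b} → ℕ ↠ A → (check : (x : A) → Maybe (Output x)) →
         Merely (Σ A λ x → T (is-just (check x))) → Σ A Output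
search enum check succeeds =
  let (n , ok) = ℕ-search (is-just ∘ check ∘ to) (do
        (x , ok) ← succeeds
        return (to⁻ x , subst (T ∘ is-just ∘ check) (sym (to∘to⁻ x)) ok))
  in to n , to-witness-T (check (to n)) ok
  where open Surjection enum

module RationalApartPoint
  (f : ℝD → ℝD) (continuous : PointwiseContinuous f) (nonconstant : LocallyNonconstant f)
  (lifts : LiftsLocators f) (x y t : ℝD) (locx : Locator x) (locy : Locator y) (loct : Locator t)
  (x<y : x <ℝ y)
  where

  Good : ℚ → Set₂
  Good r = (x <ℝℚ r) × (r <ℚℝ y) × (f (ι r) # t)

  -- A certificate (a , r , b , c) proposes the point r, with x < a < r
  -- confirming x < r, r < b < y confirming r < y, and c a triple
  -- certifying f r # t.
  Certificate : Set
  Certificate = ℚ × ℚ × ℚ × Triple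

  point : Certificate → ℚ
  point (_ , r , _) = r

  ℕ↠Certificate : ℕ ↠ Certificate
  ℕ↠Certificate = ℕ↠ℚ ⊗ (ℕ↠ℚ ⊗ (ℕ↠ℚ ⊗ (ℕ↠ℚ ⊗ (ℕ↠ℚ ⊗ ℕ↠ℚ))))

  -- Checking a certificate with the locators; f (ι r) is located because
  -- f lifts the locator of the rational r.
  check : (κ : Certificate) → Maybe (Good (point κ))
  check (a , r , b , c) =
    zip (upper? x locx a r) (zip (lower? y locy r b) (apart? (f (ι r)) (lifts (ι r) (ι-locator r)) t loct c))

  certificate-exists : Merely (Σ Certificate λ κ → T (is-just (check κ)))
  certificate-exists = do
    (z , x<z , z<y , fz#t) ← merely (nonconstant x y x<y t)
    (a , x<a , a<z) ← merely x<z
    (b , z<b , b<y) ← merely z<y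
    ((δ , 0<δ) , near) ← apart-persists f continuous z t fz#t
    (r , a<r , r<b , z≈r) ← rational-near z a<z z<b δ 0<δ
    (c , c-ok) ← apart?-complete (f (ι r)) (lifts (ι r) (ι-locator r)) t loct (near (ι r) z≈r)
    return ((a , r , b , c) ,
            is-just-zip _ _ (upper?-complete x locx x<a a<r)
                            (is-just-zip _ _ (lower?-complete y locy b<y r<b) c-ok))

  result : Σ ℚ Good
  result = let (κ , good) = search ℕ↠Certificate check certificate-exists in point κ , good

lemma4p15 : (f : ℝD → ℝD) → PointwiseContinuous f → LocallyNonconstant f →
            LiftsLocators f →
            (x y t : ℝD) → Locator x → Locator y → Locator t → x <ℝ y →
            Σ ℚ (λ r → (x <ℝℚ r) × (r <ℚℝ y) × (f (ι r) # t))
lemma4p15 f continuous nonconstant lifts x y t locx locy loct x<y =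
  RationalApartPoint.result f continuous nonconstant lifts x y t locx locy loct x<y
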